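{- Let $\Psi\subset\Delta^+_\ell$ be a root ideal and $\gamma\in\mathbb Z^\ell$ with $\gamma_\ell=0$. Then $H(\Psi;\gamma)=H(\hat\Psi;\hat\gamma)$, where $\hat\Psi=\{(i,j)\in\Psi:j<\ell\}\subset\Delta^+_{\ell-1}$ and $\hat\gamma=(\gamma_1,\dots,\gamma_{\ell-1})$.
   Context: For $\gamma\in\mathbb Z^n$, $s_\gamma=\det(h_{\gamma_i+j-i})_{1\le i,j\le n}$ ($h_0=1$, $h_d=0$ for $d<0$). $\Delta^+_n=\{(i,j):1\le i<j\le n\}$ with order $(a,b)\le(c,d)$ iff $a\ge c$ and $b\le d$; a root ideal is an upper order ideal. For a root ideal $\Psi\subset\Delta^+_n$ and $\gamma\in\mathbb Z^n$, $H(\Psi;\gamma)$ is obtained by expanding $\prod_{(i,j)\in\Psi}(1-tz_i/z_j)^{ -1}z^\gamma$ as a power series in $t$ and applying coefficientwise the linear map $z^\beta\mapsto s_\beta$ (an element of the ring of symmetric functions over $\mathbb Q(t)$). -}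

module Defs where

open import Data.Nat as ℕ using (ℕ; zero; suc; _∸_)
open import Data.Integer as ℤ using (ℤ; +_; -[1+_])
open import Data.Fin as Fin using (Fin; zero; suc; toℕ; punchIn; _<_; _≤_)
open import Data.Fin.Properties using (_≟_)
open import Data.Bool using (Bool; true; false; T; if_then_else_)
open import Data.List using (List; []; _∷_; concatMap; allFin)
open import Data.Product using (_×_; _,_)
open import Relation.Nullary using (does)
open import Algebra.Bundles using (CommutativeRing)

-- A subset Ψ of pairs (i , j) of Fin n (0-indexed), given by a Boolean predicate.
Pairs : ℕ → Set
Pairs n = Fin n → Fin n → Bool

IsRootIdeal : (n : ℕ) → Pairs n → Set
IsRootIdeal n Ψ =
  (∀ i j → T (Ψ i j) → i < j) ×
  (∀ a b c d → T (Ψ a b) → c ≤ a → b ≤ d → c < d → T (Ψ c d))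

rootList : (n : ℕ) → Pairs n → List (Fin n × Fin n)
rootList n Ψ =
  concatMap (λ i → concatMap (λ j → if Ψ i j then (i , j) ∷ [] else []) (allFin n)) (allFin n)

shift : ∀ {n} → (Fin n → ℤ) → Fin n × Fin n → ℕ → Fin n → ℤ
shift γ (i , j) k x =
  (γ x ℤ.+ (if does (i ≟ x) then + k else + 0)) ℤ.- (if does (j ≟ x) then + k else + 0)

module _ {c ℓ} (R : CommutativeRing c ℓ) where
  open CommutativeRing R using (Carrier; 0#; 1#; _+_; _*_; -_)

  -- h_d for d ∈ ℤ, with h_d = 0 for d < 0 (h 0 is required to be 1 in the statement)
  hℤ : (ℕ → Carrier) → ℤ → Carrier
  hℤ h (+ n) = h n
  hℤ h -[1+ n ] = 0#

  sumFin : ∀ {n} → (Fin n → Carrier) → Carrier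
  sumFin {zero} f = 0#
  sumFin {suc n} f = f zero + sumFin (λ i → f (suc i))

  signed : ℕ → Carrier → Carrier
  signed zero x = x
  signed (suc k) x = - signed k x

  det : (n : ℕ) → (Fin n → Fin n → Carrier) → Carrier
  det zero M = 1#
  det (suc n) M =
    sumFin (λ j → signed (toℕ j) (M zero j * det n (λ a b → M (suc a) (punchIn j b))))

  schur : (ℕ → Carrier) → (n : ℕ) → (Fin n → ℤ) → Carrier
  schur h n γ = det n (λ i j → hℤ h ((γ i ℤ.+ + toℕ j) ℤ.- + toℕ i))

  -- coefficient of t^d in  ∏_{r ∈ rs} (1 - t z_i/z_j)^{-1} z^γ  after applying z^β ↦ s_β
  Hcoeff : (ℕ → Carrier) → (n : ℕ) → List (Fin n × Fin n) → (Fin n → ℤ) → ℕ → Carrier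
  Hcoeff h n [] γ zero = schur h n γ
  Hcoeff h n [] γ (suc d) = 0#
  Hcoeff h n (r ∷ rs) γ d =
    sumFin {suc d} (λ k → Hcoeff h n rs (shift γ r (toℕ k)) (d ∸ toℕ k))

  H : (ℕ → Carrier) → (n : ℕ) → Pairs n → (Fin n → ℤ) → ℕ → Carrier
  H h n Ψ γ d = Hcoeff h n (rootList n Ψ) γ d

-- Write t^k z_i/z_ℓ z^γ = z^{γ + k(e_i - e_ℓ)}.  Each root (i , ℓ) in the last column can only
-- lower the last exponent, and the other roots never touch it since no root starts in row ℓ
-- (this, Ψ ⊆ Δ⁺, is all that is used of Ψ being a root ideal).
-- A Schur determinant whose last exponent is negative has a zero last row, while one whose
-- last exponent is 0 has last row (0, …, 0, h₀) = (0, …, 0, 1), so it expands to the Schur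
-- determinant of the first ℓ - 1 exponents.  Hence only the k = 0 terms of the last-column
-- factors survive, and what remains is exactly the expansion of H(Ψ̂; γ̂).
module Submission where

open import Defs
open import Data.Nat as ℕ using (ℕ; zero; suc; _∸_)
import Data.Nat.Properties as ℕ
open import Data.Integer as ℤ using (ℤ; +_; 0ℤ; _-_; -<+; +<+; +≤+)
import Data.Integer.Properties as ℤ
open import Data.Fin using (Fin; zero; suc; toℕ; punchIn; fromℕ; inject₁)
open import Data.Fin.Properties
  using (_≟_; toℕ-inject₁; toℕ-fromℕ; toℕ<n; toℕ≤pred[n]; ≤fromℕ; fromℕ≢inject₁; inject₁-injective)
open import Data.Bool using (true; false; if_then_else_)
open import Data.Bool.Properties using (if-eta)
open import Data.List using (List; []; _∷_; _++_; concat; tabulate)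
open import Data.List.Properties using (map-tabulate; tabulate-cong)
open import Data.Product using (_×_; _,_; proj₁)
open import Data.Unit using (tt)
open import Data.Empty using (⊥-elim)
open import Function using (_∘_; id; mk⇔)
open import Relation.Nullary using (does)
open import Relation.Nullary.Decidable using (dec-true; dec-false; does-⇔)
open import Relation.Binary.PropositionalEquality
  using (_≡_; _≢_; _≗_; refl; sym; trans; cong; cong₂; subst₂)
open import Algebra.Bundles using (CommutativeRing)

punchIn-fromℕ : ∀ {m} (b : Fin m) → punchIn (fromℕ m) b ≡ inject₁ b
punchIn-fromℕ zero = refl
punchIn-fromℕ (suc b) = cong suc (punchIn-fromℕ b)

punchIn-inject₁ : ∀ {m} (j : Fin (suc m)) (b : Fin m) →
  punchIn (inject₁ j) (inject₁ b) ≡ inject₁ (punchIn j b)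
punchIn-inject₁ zero b = refl
punchIn-inject₁ (suc j) zero = refl
punchIn-inject₁ (suc j) (suc b) = cong suc (punchIn-inject₁ j b)

punchIn-inject₁-fromℕ : ∀ {m} (j : Fin (suc m)) → punchIn (inject₁ j) (fromℕ m) ≡ fromℕ (suc m)
punchIn-inject₁-fromℕ zero = refl
punchIn-inject₁-fromℕ {suc m} (suc j) = cong suc (punchIn-inject₁-fromℕ j)

inject₁≢fromℕ : ∀ {m} (i : Fin m) → inject₁ i ≢ fromℕ m
inject₁≢fromℕ i = fromℕ≢inject₁ ∘ sym

does-inject₁-≟ : ∀ {m} (a b : Fin m) → does (inject₁ a ≟ inject₁ b) ≡ does (a ≟ b)
does-inject₁-≟ a b = does-⇔ (mk⇔ inject₁-injective (cong inject₁)) (inject₁ a ≟ inject₁ b) (a ≟ b)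

leadingMinor : ∀ {a} {A : Set a} {n} → (Fin (suc n) → Fin (suc n) → A) → Fin n → Fin n → A
leadingMinor M a b = M (inject₁ a) (inject₁ b)

i<j⇒i-j<0 : ∀ {i j} → i ℤ.< j → i - j ℤ.< 0ℤ
i<j⇒i-j<0 {i} {j} i<j = subst₂ ℤ._<_ refl (ℤ.+-inverseʳ j) (ℤ.+-monoˡ-< (ℤ.- j) i<j)

shift-cong : ∀ {n} {γ γ′ : Fin n → ℤ} r k → γ ≗ γ′ → shift γ r k ≗ shift γ′ r k
shift-cong (i , j) k γ≗γ′ x =
  cong (λ z → (z ℤ.+ (if does (i ≟ x) then + k else + 0)) - (if does (j ≟ x) then + k else + 0)) (γ≗γ′ x)

shift-zero : ∀ {n} (γ : Fin n → ℤ) r → shift γ r 0 ≗ γ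
shift-zero γ (i , j) x rewrite if-eta (does (i ≟ x)) {+ 0} | if-eta (does (j ≟ x)) {+ 0} =
  trans (ℤ.+-identityʳ _) (ℤ.+-identityʳ _)

shift-apart : ∀ {n} (γ : Fin n → ℤ) {i j x} k → i ≢ x → j ≢ x → shift γ (i , j) k x ≡ γ x
shift-apart γ {i} {j} {x} k i≢x j≢x rewrite dec-false (i ≟ x) i≢x | dec-false (j ≟ x) j≢x =
  trans (ℤ.+-identityʳ _) (ℤ.+-identityʳ _)

shift-target : ∀ {n} (γ : Fin n → ℤ) {i j} k → i ≢ j → shift γ (i , j) k j ≡ γ j - + k
shift-target γ {i} {j} k i≢j rewrite dec-false (i ≟ j) i≢j | ℤ.+-identityʳ (γ j) | dec-true (j ≟ j) refl = refl

shift-≤ : ∀ {n} (γ : Fin n → ℤ) {i x} j k → i ≢ x → shift γ (i , j) k x ℤ.≤ γ x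
shift-≤ γ {i} {x} j k i≢x rewrite dec-false (i ≟ x) i≢x | ℤ.+-identityʳ (γ x) with does (j ≟ x)
... | true = ℤ.i-j≤i (γ x) (+ k)
... | false = ℤ.i-j≤i (γ x) (+ 0)

shift-inject₁ : ∀ {n} (γ : Fin (suc n) → ℤ) (i j : Fin n) k →
  shift γ (inject₁ i , inject₁ j) k ∘ inject₁ ≗ shift (γ ∘ inject₁) (i , j) k
shift-inject₁ γ i j k x rewrite does-inject₁-≟ i x | does-inject₁-≟ j x = refl

-- The list analogue of Ψ ↦ Ψ̂; it also records that no root of rs lies in the last row.
data DropLastColumn {n} : List (Fin (suc n) × Fin (suc n)) → List (Fin n × Fin n) → Set where
  [] : DropLastColumn [] []
  keep : ∀ {i j rs qs} → DropLastColumn rs qs →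
    DropLastColumn ((inject₁ i , inject₁ j) ∷ rs) ((i , j) ∷ qs)
  drop : ∀ {i rs qs} → DropLastColumn rs qs → DropLastColumn ((inject₁ i , fromℕ n) ∷ rs) qs

DropLastColumn-++ : ∀ {n} {rs rs′ : List (Fin (suc n) × Fin (suc n))} {qs qs′} →
  DropLastColumn rs qs → DropLastColumn rs′ qs′ → DropLastColumn (rs ++ rs′) (qs ++ qs′)
DropLastColumn-++ [] ρ′ = ρ′
DropLastColumn-++ (keep ρ) ρ′ = keep (DropLastColumn-++ ρ ρ′)
DropLastColumn-++ (drop ρ) ρ′ = drop (DropLastColumn-++ ρ ρ′)

DropLastColumn-concat-[] : ∀ {n m} {F : Fin m → List (Fin (suc n) × Fin (suc n))} →
  (∀ i → DropLastColumn (F i) []) → DropLastColumn (concat (tabulate F)) []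
DropLastColumn-concat-[] {m = zero} ρ = []
DropLastColumn-concat-[] {m = suc m} {F} ρ =
  DropLastColumn-++ (ρ zero) (DropLastColumn-concat-[] {F = F ∘ suc} (ρ ∘ suc))

DropLastColumn-concat : ∀ {n m} {F : Fin (suc m) → List (Fin (suc n) × Fin (suc n))}
  {G : Fin m → List (Fin n × Fin n)} →
  (∀ i → DropLastColumn (F (inject₁ i)) (G i)) → DropLastColumn (F (fromℕ m)) [] →
  DropLastColumn (concat (tabulate F)) (concat (tabulate G))
DropLastColumn-concat {m = zero} ρ ρₗ = DropLastColumn-++ ρₗ []
DropLastColumn-concat {m = suc m} {F} {G} ρ ρₗ =
  DropLastColumn-++ (ρ zero) (DropLastColumn-concat {F = F ∘ suc} {G = G ∘ suc} (ρ ∘ suc) ρₗ)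

rootCell : ∀ {m} → Pairs m → Fin m → Fin m → List (Fin m × Fin m)
rootCell Ψ i j = if Ψ i j then (i , j) ∷ [] else []

rootRow : ∀ {m} → Pairs m → Fin m → List (Fin m × Fin m)
rootRow Ψ i = concat (tabulate (rootCell Ψ i))

rootList-tabulate : ∀ m (Ψ : Pairs m) → rootList m Ψ ≡ concat (tabulate (rootRow Ψ))
rootList-tabulate m Ψ = trans (cong concat (map-tabulate {n = m} id _))
  (cong concat (tabulate-cong (λ i → cong concat (map-tabulate {n = m} id (rootCell Ψ i)))))

rootList-DropLastColumn : ∀ {n} {Ψ : Pairs (suc n)} → IsRootIdeal (suc n) Ψ →
  DropLastColumn (rootList (suc n) Ψ) (rootList n (leadingMinor Ψ))
rootList-DropLastColumn {n} {Ψ} isRootIdeal =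
  subst₂ DropLastColumn (sym (rootList-tabulate (suc n) Ψ)) (sym (rootList-tabulate n (leadingMinor Ψ)))
    (DropLastColumn-concat {F = rootRow Ψ} {G = rootRow (leadingMinor Ψ)}
      (λ i → DropLastColumn-concat {F = rootCell Ψ (inject₁ i)} (keepCell i) (dropCell i))
      (DropLastColumn-concat-[] {F = rootCell Ψ (fromℕ n)} lastRowCell))
  where
  keepCell : ∀ i j → DropLastColumn (rootCell Ψ (inject₁ i) (inject₁ j)) (rootCell (leadingMinor Ψ) i j)
  keepCell i j with Ψ (inject₁ i) (inject₁ j)
  ... | true = keep []
  ... | false = []
  dropCell : ∀ i → DropLastColumn (rootCell Ψ (inject₁ i) (fromℕ n)) []
  dropCell i with Ψ (inject₁ i) (fromℕ n)
  ... | true = drop []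
  ... | false = []
  lastRowCell : ∀ j → DropLastColumn (rootCell Ψ (fromℕ n) j) []
  lastRowCell j with Ψ (fromℕ n) j | proj₁ isRootIdeal (fromℕ n) j
  ... | true | last<j = ⊥-elim (ℕ.<⇒≱ (last<j tt) (≤fromℕ j))
  ... | false | _ = []

module _ {c ℓ} (R : CommutativeRing c ℓ) where
  open CommutativeRing R hiding (zero; _-_) renaming (refl to ≈-refl; trans to ≈-trans)
  open import Algebra.Properties.Ring ring using (-‿distribʳ-*; -0#≈0#)
  open import Algebra.Properties.CommutativeSemigroup *-commutativeSemigroup using (x∙yz≈y∙xz)
  open import Algebra.Properties.Semiring.Sum semiring
    using (sum; sum-cong-≋; sum-replicate-zero; sum-init-last; *-distribˡ-sum)
  open import Relation.Binary.Reasoning.Setoid setoid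

  sumFin≡sum : ∀ {n} (f : Fin n → Carrier) → sumFin R f ≡ sum f
  sumFin≡sum {zero} f = refl
  sumFin≡sum {suc n} f = cong (_+_ (f zero)) (sumFin≡sum (f ∘ suc))

  sumFin-cong : ∀ {n} {f g : Fin n → Carrier} → (∀ i → f i ≈ g i) → sumFin R f ≈ sumFin R g
  sumFin-cong {f = f} {g} f≈g = begin
    sumFin R f ≡⟨ sumFin≡sum f ⟩
    sum f      ≈⟨ sum-cong-≋ f≈g ⟩
    sum g      ≡⟨ sumFin≡sum g ⟨
    sumFin R g ∎

  sumFin-zero : ∀ {n} {f : Fin n → Carrier} → (∀ i → f i ≈ 0#) → sumFin R f ≈ 0#
  sumFin-zero {n} {f} f≈0 = begin
    sumFin R f ≡⟨ sumFin≡sum f ⟩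
    sum f      ≈⟨ sum-cong-≋ f≈0 ⟩
    sum {n} (λ _ → 0#) ≈⟨ sum-replicate-zero n ⟩
    0#         ∎

  sumFin-head : ∀ {n} {f : Fin (suc n) → Carrier} {x} →
    f zero ≈ x → (∀ i → f (suc i) ≈ 0#) → sumFin R f ≈ x
  sumFin-head f₀≈x rest≈0 = ≈-trans (+-cong f₀≈x (sumFin-zero rest≈0)) (+-identityʳ _)

  signed-cong : ∀ k {x y} → x ≈ y → signed R k x ≈ signed R k y
  signed-cong zero x≈y = x≈y
  signed-cong (suc k) x≈y = -‿cong (signed-cong k x≈y)

  signed-distribʳ-* : ∀ k x y → signed R k (x * y) ≈ x * signed R k y
  signed-distribʳ-* zero x y = ≈-refl
  signed-distribʳ-* (suc k) x y = ≈-trans (-‿cong (signed-distribʳ-* k x y)) (-‿distribʳ-* x _)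

  signed-zero : ∀ k → signed R k 0# ≈ 0#
  signed-zero zero = ≈-refl
  signed-zero (suc k) = ≈-trans (-‿cong (signed-zero k)) -0#≈0#

  firstRowMinor : ∀ {n} → (Fin (suc n) → Fin (suc n) → Carrier) → Fin (suc n) → Fin n → Fin n → Carrier
  firstRowMinor M j a b = M (suc a) (punchIn j b)

  laplaceTerm : ∀ {n} → (Fin (suc n) → Fin (suc n) → Carrier) → Fin (suc n) → Carrier
  laplaceTerm {n} M j = signed R (toℕ j) (M zero j * det R n (firstRowMinor M j))

  det-cong : ∀ n {M N : Fin n → Fin n → Carrier} → (∀ i j → M i j ≈ N i j) → det R n M ≈ det R n N
  det-cong zero M≈N = ≈-refl
  det-cong (suc n) M≈N = sumFin-cong (λ j → signed-cong (toℕ j)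
    (*-cong (M≈N zero j) (det-cong n (λ a b → M≈N (suc a) (punchIn j b)))))

  det-lastRowCorner : ∀ n (M : Fin (suc n) → Fin (suc n) → Carrier) →
    (∀ j → M (fromℕ n) (inject₁ j) ≈ 0#) →
    det R (suc n) M ≈ M (fromℕ n) (fromℕ n) * det R n (leadingMinor M)

  det-zeroLastRow : ∀ n (M : Fin (suc n) → Fin (suc n) → Carrier) →
    (∀ j → M (fromℕ n) j ≈ 0#) → det R (suc n) M ≈ 0#
  det-zeroLastRow n M lastRow≈0 =
    ≈-trans (det-lastRowCorner n M (lastRow≈0 ∘ inject₁)) (≈-trans (*-congʳ (lastRow≈0 (fromℕ n))) (zeroˡ _))

  det-lastRowCorner zero M _ = +-identityʳ _
  det-lastRowCorner (suc m) M lastRow≈0 = begin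
    det R (suc (suc m)) M                                ≡⟨ sumFin≡sum (laplaceTerm M) ⟩
    sum (laplaceTerm M)                                  ≈⟨ sum-init-last (laplaceTerm M) ⟩
    sum (laplaceTerm M ∘ inject₁) + laplaceTerm M (fromℕ (suc m))
      ≈⟨ +-cong (sum-cong-≋ term-inject₁) term-fromℕ ⟩
    sum (λ j → corner * laplaceTerm M′ j) + 0# ≈⟨ +-identityʳ _ ⟩
    sum (λ j → corner * laplaceTerm M′ j)      ≈⟨ *-distribˡ-sum corner (laplaceTerm M′) ⟨
    corner * sum (laplaceTerm M′)              ≡⟨ cong (_*_ corner) (sumFin≡sum (laplaceTerm M′)) ⟨
    corner * det R (suc m) M′                  ∎
    where
    M′ : Fin (suc m) → Fin (suc m) → Carrier
    M′ = leadingMinor M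
    corner : Carrier
    corner = M (fromℕ (suc m)) (fromℕ (suc m))
    term-inject₁ : ∀ j → laplaceTerm M (inject₁ j) ≈ corner * laplaceTerm M′ j
    term-inject₁ j = begin
      signed R (toℕ (inject₁ j)) (M zero (inject₁ j) * det R (suc m) N)
        ≡⟨ cong (λ k → signed R k (M zero (inject₁ j) * det R (suc m) N)) (toℕ-inject₁ j) ⟩
      signed R (toℕ j) (M zero (inject₁ j) * det R (suc m) N)
        ≈⟨ signed-cong (toℕ j) (*-congˡ (det-lastRowCorner m N
             (λ b → ≈-trans (reflexive (cong (M (fromℕ (suc m))) (punchIn-inject₁ j b)))
                          (lastRow≈0 (punchIn j b))))) ⟩
      signed R (toℕ j) (M zero (inject₁ j) * (N (fromℕ m) (fromℕ m) * det R m (leadingMinor N)))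
        ≈⟨ signed-cong (toℕ j) (*-congˡ (*-cong
             (reflexive (cong (M (fromℕ (suc m))) (punchIn-inject₁-fromℕ j)))
             (det-cong m (λ a b → reflexive (cong (M (suc (inject₁ a))) (punchIn-inject₁ j b)))))) ⟩
      signed R (toℕ j) (M zero (inject₁ j) * (corner * det R m (firstRowMinor M′ j)))
        ≈⟨ signed-cong (toℕ j) (x∙yz≈y∙xz _ _ _) ⟩
      signed R (toℕ j) (corner * (M zero (inject₁ j) * det R m (firstRowMinor M′ j)))
        ≈⟨ signed-distribʳ-* (toℕ j) corner _ ⟩
      corner * laplaceTerm M′ j ∎
      where
      N : Fin (suc m) → Fin (suc m) → Carrier
      N = firstRowMinor M (inject₁ j)
    term-fromℕ : laplaceTerm M (fromℕ (suc m)) ≈ 0#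
    term-fromℕ = ≈-trans
      (signed-cong (toℕ (fromℕ (suc m))) (≈-trans (*-congˡ (det-zeroLastRow m (firstRowMinor M (fromℕ (suc m)))
        (λ b → ≈-trans (reflexive (cong (M (fromℕ (suc m))) (punchIn-fromℕ b))) (lastRow≈0 b))))
        (zeroʳ _)))
      (signed-zero (toℕ (fromℕ (suc m))))

  module _ (h : ℕ → Carrier) where

    schurMatrix : (n : ℕ) → (Fin n → ℤ) → Fin n → Fin n → Carrier
    schurMatrix n γ i j = hℤ R h ((γ i ℤ.+ + toℕ j) - + toℕ i)

    hℤ-negative : ∀ {z} → z ℤ.< 0ℤ → hℤ R h z ≡ 0#
    hℤ-negative {ℤ.-[1+ _ ]} _ = refl
    hℤ-negative {+ _} (+<+ ())

    schurMatrix-lastRow : ∀ n (γ : Fin (suc n) → ℤ) (j : Fin (suc n)) →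
      γ (fromℕ n) ℤ.+ + toℕ j ℤ.< + n → schurMatrix (suc n) γ (fromℕ n) j ≈ 0#
    schurMatrix-lastRow n γ j lt rewrite toℕ-fromℕ n = reflexive (hℤ-negative (i<j⇒i-j<0 lt))

    schur-lastNegative : ∀ n (γ : Fin (suc n) → ℤ) → γ (fromℕ n) ℤ.< 0ℤ → schur R h (suc n) γ ≈ 0#
    schur-lastNegative n γ γₗ<0 = det-zeroLastRow n (schurMatrix (suc n) γ)
      (λ j → schurMatrix-lastRow n γ j (ℤ.+-mono-<-≤ γₗ<0 (+≤+ (toℕ≤pred[n] j))))

    schur-lastZero : h 0 ≈ 1# → ∀ n (γ : Fin (suc n) → ℤ) → γ (fromℕ n) ≡ 0ℤ →
      schur R h (suc n) γ ≈ schur R h n (γ ∘ inject₁)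
    schur-lastZero h₀≈1 n γ γₗ≡0 = begin
      det R (suc n) (schurMatrix (suc n) γ)
        ≈⟨ det-lastRowCorner n (schurMatrix (suc n) γ) offDiagonal ⟩
      schurMatrix (suc n) γ (fromℕ n) (fromℕ n) * det R n (leadingMinor (schurMatrix (suc n) γ))
        ≈⟨ *-cong corner (det-cong n minor) ⟩
      1# * det R n (schurMatrix n (γ ∘ inject₁))
        ≈⟨ *-identityˡ _ ⟩
      det R n (schurMatrix n (γ ∘ inject₁)) ∎
      where
      offDiagonal : ∀ j → schurMatrix (suc n) γ (fromℕ n) (inject₁ j) ≈ 0#
      offDiagonal j = schurMatrix-lastRow n γ (inject₁ j) lt
        where
        lt : γ (fromℕ n) ℤ.+ + toℕ (inject₁ j) ℤ.< + n
        lt rewrite γₗ≡0 | toℕ-inject₁ j = +<+ (toℕ<n j)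
      corner : schurMatrix (suc n) γ (fromℕ n) (fromℕ n) ≈ 1#
      corner rewrite γₗ≡0 = ≈-trans (reflexive (cong (hℤ R h) (ℤ.+-inverseʳ (+ toℕ (fromℕ n))))) h₀≈1
      minor : ∀ a b → schurMatrix (suc n) γ (inject₁ a) (inject₁ b) ≈ schurMatrix n (γ ∘ inject₁) a b
      minor a b = reflexive (cong₂ (λ k l → hℤ R h ((γ (inject₁ a) ℤ.+ + k) - + l))
        (toℕ-inject₁ b) (toℕ-inject₁ a))

    HcoeffTerm : ∀ n → Fin n × Fin n → List (Fin n × Fin n) → (Fin n → ℤ) → ∀ d → Fin (suc d) → Carrier
    HcoeffTerm n r rs γ d k = Hcoeff R h n rs (shift γ r (toℕ k)) (d ∸ toℕ k)

    Hcoeff-cong : ∀ {n} rs {γ γ′ : Fin n → ℤ} → γ ≗ γ′ → ∀ d → Hcoeff R h n rs γ d ≈ Hcoeff R h n rs γ′ d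
    Hcoeff-cong {n} [] γ≗γ′ zero =
      det-cong n (λ i j → reflexive (cong (λ z → hℤ R h ((z ℤ.+ + toℕ j) - + toℕ i)) (γ≗γ′ i)))
    Hcoeff-cong [] γ≗γ′ (suc d) = ≈-refl
    Hcoeff-cong {n} (r ∷ rs) {γ} {γ′} γ≗γ′ d =
      sumFin-cong {f = HcoeffTerm n r rs γ d} {g = HcoeffTerm n r rs γ′ d}
        (λ k → Hcoeff-cong rs (shift-cong r (toℕ k) γ≗γ′) (d ∸ toℕ k))

    Hcoeff-lastNegative : ∀ {n rs qs} → DropLastColumn rs qs → ∀ {γ : Fin (suc n) → ℤ} →
      γ (fromℕ n) ℤ.< 0ℤ → ∀ d → Hcoeff R h (suc n) rs γ d ≈ 0#
    Hcoeff-lastNegative {n} [] {γ} γₗ<0 zero = schur-lastNegative n γ γₗ<0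
    Hcoeff-lastNegative [] γₗ<0 (suc d) = ≈-refl
    Hcoeff-lastNegative {n} (keep {i} {j} {rs} ρ) {γ} γₗ<0 d =
      sumFin-zero {f = HcoeffTerm (suc n) (inject₁ i , inject₁ j) rs γ d} (λ k → Hcoeff-lastNegative ρ
        (ℤ.≤-<-trans (shift-≤ γ (inject₁ j) (toℕ k) (inject₁≢fromℕ i)) γₗ<0) (d ∸ toℕ k))
    Hcoeff-lastNegative {n} (drop {i} {rs} ρ) {γ} γₗ<0 d =
      sumFin-zero {f = HcoeffTerm (suc n) (inject₁ i , fromℕ n) rs γ d} (λ k → Hcoeff-lastNegative ρ
        (ℤ.≤-<-trans (shift-≤ γ (fromℕ n) (toℕ k) (inject₁≢fromℕ i)) γₗ<0) (d ∸ toℕ k))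

    Hcoeff-DropLastColumn : h 0 ≈ 1# → ∀ {n rs qs} → DropLastColumn rs qs →
      ∀ {γ : Fin (suc n) → ℤ} → γ (fromℕ n) ≡ 0ℤ →
      ∀ d → Hcoeff R h (suc n) rs γ d ≈ Hcoeff R h n qs (γ ∘ inject₁) d
    Hcoeff-DropLastColumn h₀≈1 {n} [] {γ} γₗ≡0 zero = schur-lastZero h₀≈1 n γ γₗ≡0
    Hcoeff-DropLastColumn h₀≈1 [] γₗ≡0 (suc d) = ≈-refl
    Hcoeff-DropLastColumn h₀≈1 {n} (keep {i} {j} {rs} {qs} ρ) {γ} γₗ≡0 d =
      sumFin-cong {f = HcoeffTerm (suc n) (inject₁ i , inject₁ j) rs γ d}
                  {g = HcoeffTerm n (i , j) qs (γ ∘ inject₁) d}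
        (λ k → ≈-trans
          (Hcoeff-DropLastColumn h₀≈1 ρ
            (trans (shift-apart γ (toℕ k) (inject₁≢fromℕ i) (inject₁≢fromℕ j)) γₗ≡0) (d ∸ toℕ k))
          (Hcoeff-cong qs (shift-inject₁ γ i j (toℕ k)) (d ∸ toℕ k)))
    Hcoeff-DropLastColumn h₀≈1 {n} (drop {i} {rs} {qs} ρ) {γ} γₗ≡0 d =
      sumFin-head {f = HcoeffTerm (suc n) (inject₁ i , fromℕ n) rs γ d}
        (≈-trans (Hcoeff-cong rs (shift-zero γ (inject₁ i , fromℕ n)) d) (Hcoeff-DropLastColumn h₀≈1 ρ γₗ≡0 d))
        (λ k → Hcoeff-lastNegative ρ (lastNegative (toℕ k)) (d ∸ suc (toℕ k)))
      where
      lastNegative : ∀ k → shift γ (inject₁ i , fromℕ n) (suc k) (fromℕ n) ℤ.< 0ℤ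
      lastNegative k rewrite shift-target γ (suc k) (inject₁≢fromℕ i) | γₗ≡0 = -<+

proposition4p12 : ∀ {c ℓ} (R : CommutativeRing c ℓ) (h : ℕ → CommutativeRing.Carrier R) →
    CommutativeRing._≈_ R (h 0) (CommutativeRing.1# R) →
    (n : ℕ) (Ψ : Pairs (suc n)) → IsRootIdeal (suc n) Ψ →
    (γ : Fin (suc n) → ℤ) → γ (fromℕ n) ≡ + 0 →
    (d : ℕ) →
    CommutativeRing._≈_ R (H R h (suc n) Ψ γ d)
      (H R h n (λ i j → Ψ (inject₁ i) (inject₁ j)) (γ ∘ inject₁) d)
proposition4p12 R h h₀≈1 n Ψ isRootIdeal γ γₗ≡0 =
  Hcoeff-DropLastColumn R h h₀≈1 (rootList-DropLastColumn isRootIdeal) γₗ≡0
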